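{- Let $n\ge1$ and let $PL(n)$ be the number of distinct lengths of the sequences $B(\lambda)$ as $\lambda$ ranges over all palindrome partitions of $n$. Then $PL(n)$ equals the number of pairs of integers $(x,y)$ with $xy=2(n+1)$ and $0<x\le y\le n+1$. Moreover, if $\lambda\vdash n$ is a palindrome partition with $B(\lambda)$ of length $m=A+B$ having $A$ zeros and $B$ ones, then every palindrome partition $\mu\vdash n$ with $B(\mu)$ of length $m$ has either $A$ zeros and $B$ ones, or $B$ zeros and $A$ ones.
   Context: For a partition $\lambda$ with $\lambda_1$ columns and $\ell$ nonzero rows, the southeast boundary of its Young diagram is a lattice path from the bottom-left to the top-right corner with $\lambda_1$ right steps and $\ell$ up steps, the first step right and the last step up. Writing $1$ for each right step and $0$ for each up step, read southwest to northeast, and deleting the first entry (a $1$) and last entry (a $0$), gives the binary sequence $B(\lambda)$ of length $\lambda_1+\ell-2$ (with $\ell-1$ zeros and $\lambda_1-1$ ones). A partition $\lambda\vdash n$ is a palindrome partition if $B(\lambda)$ equals its reverse. -}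

module Defs where

open import Data.Bool using (Bool; true; false)
open import Data.Nat using (ℕ; zero; suc; _+_; _*_; _∸_; _≤_; _<_; _≥_; _≟_; _≤?_; _<?_)
open import Data.List using (List; []; _∷_; _++_; replicate; reverse; drop; take; length; filter; upTo; concatMap; map)
open import Data.Nat.ListAction using (sum)
open import Data.List.Relation.Unary.All using (All)
open import Data.List.Relation.Unary.Linked using (Linked)
open import Data.Product using (_×_; _,_; proj₁; proj₂)
open import Relation.Binary.PropositionalEquality using (_≡_)
open import Relation.Nullary.Decidable using (Dec; _×-dec_)

IsPartition : ℕ → List ℕ → Set
IsPartition n λs = Linked _≥_ λs × All (0 <_) λs × sum λs ≡ n

-- Southeast boundary path, read southwest to northeast, for the parts listed
-- in increasing order (λ_ℓ, …, λ₁); true = right step (1), false = up step (0).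
boundaryAux : ℕ → List ℕ → List Bool
boundaryAux p []       = []
boundaryAux p (x ∷ xs) = replicate (x ∸ p) true ++ (false ∷ boundaryAux x xs)

boundary : List ℕ → List Bool
boundary λs = boundaryAux 0 (reverse λs)

dropLast : List Bool → List Bool
dropLast w = take (length w ∸ 1) w

B : List ℕ → List Bool
B λs = dropLast (drop 1 (boundary λs))

IsPalindromePartition : ℕ → List ℕ → Set
IsPalindromePartition n λs = IsPartition n λs × B λs ≡ reverse (B λs)

zeros : List Bool → ℕ
zeros []           = 0
zeros (false ∷ w)  = suc (zeros w)
zeros (true ∷ w)   = zeros w

ones : List Bool → ℕ
ones []            = 0
ones (true ∷ w)    = suc (ones w)
ones (false ∷ w)   = ones w

pairsUpTo : ℕ → List (ℕ × ℕ)
pairsUpTo n = concatMap (λ x → map (λ y → (x , y)) (upTo (suc (suc n)))) (upTo (suc (suc n)))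

GoodPair : ℕ → ℕ × ℕ → Set
GoodPair n (x , y) = (x * y ≡ 2 * (n + 1)) × (0 < x) × (x ≤ y) × (y ≤ n + 1)

goodPair? : (n : ℕ) → (p : ℕ × ℕ) → Dec (GoodPair n p)
goodPair? n (x , y) = ((x * y) ≟ (2 * (n + 1))) ×-dec ((0 <? x) ×-dec ((x ≤? y) ×-dec (y ≤? n + 1)))

-- number of integer pairs (x , y) with x y = 2(n+1) and 0 < x ≤ y ≤ n+1
-- (all such pairs have 0 ≤ x , y ≤ n+1, so enumerating pairsUpTo n suffices)
numPairs : ℕ → ℕ
numPairs n = length (filter (goodPair? n) (pairsUpTo n))

{-# OPTIONS --safe #-}
-- Write the boundary word of λ ⊢ n as 1 u 0, so that B(λ) = u, with z zeros and o ones. Each up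
-- step contributes the number of right steps before it, so n = z + a(u) + o + 1, where a(u)
-- counts the pairs 1…0 in u. The pairs 0…1 are counted by a(reverse u), hence
-- a(u) + a(reverse u) = z o; for a palindrome 2 a(u) = z o, that is (z + 2)(o + 2) = 2(n + 1).
-- Conversely every word is B of a partition, and if z or o is even there is a palindrome with
-- z zeros and o ones. So the lengths of the B(λ) are the z + o over the factorisations
-- 2(n + 1) = (z + 2)(o + 2); as two numbers are determined up to order by their sum and
-- product, these lengths match the pairs x ≤ y, and equal lengths force equal or swapped counts.
module Submission where

open import Defs
open import Data.Nat using (ℕ; _≥_)
open import Data.List using (List; length)
open import Data.List.Membership.Propositional using (_∈_)
open import Data.List.Relation.Unary.Unique.Propositional using (Unique)
open import Data.Product using (_×_; Σ; ∃-syntax)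
open import Data.Sum using (_⊎_)
open import Function.Bundles using (_⇔_)
open import Relation.Binary.PropositionalEquality using (_≡_)

open import Data.Bool using (Bool; true; false)
open import Data.Nat using (zero; suc; _+_; _*_; _∸_; _≤_; _<_; z≤n; s≤s; s≤s⁻¹)
open import Data.Nat.Properties
open import Algebra.Properties.CommutativeSemigroup +-commutativeSemigroup using (x∙yz≈y∙xz)
open import Data.Nat.Tactic.RingSolver using (solve-∀)
open import Data.Nat.Divisibility using (divides; ∣-refl; ∣m+n∣m⇒∣n)
open import Data.Nat.Primality using (euclidsLemma; prime[2])
open import Data.Nat.ListAction using (sum)
open import Data.Nat.ListAction.Properties using (sum-↭)
import Data.Integer as ℤ
import Data.Integer.Properties as ℤ
import Data.Integer.Tactic.RingSolver as ℤ-Solver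
open import Data.List using ([]; _∷_; _++_; replicate; reverse; reverseAcc; take; drop; map; filter; upTo; concatMap; cartesianProduct)
open import Data.List.Properties using (++-assoc; ++-identityʳ; unfold-reverse; reverse-++; reverse-involutive; length-++; length-map)
open import Data.List.Relation.Unary.All using (All; []; _∷_)
import Data.List.Relation.Unary.All as All
open import Data.List.Relation.Unary.All.Properties using (all-filter)
open import Data.List.Relation.Unary.AllPairs using (AllPairs; []; _∷_)
import Data.List.Relation.Unary.AllPairs as AllPairs
import Data.List.Relation.Unary.AllPairs.Properties as AllPairsₚ
open import Data.List.Relation.Unary.Linked using (Linked; []; [-]; _∷_; tail)
open import Data.List.Relation.Unary.Linked.Properties using (Linked⇒All)
open import Data.List.Relation.Binary.Permutation.Propositional using (↭-sym)
open import Data.List.Relation.Binary.Permutation.Propositional.Properties using (↭-reverse; All-resp-↭)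
open import Data.List.Membership.Propositional.Properties using (∈-map⁺; ∈-map⁻; ∈-filter⁺; ∈-filter⁻; ∈-cartesianProduct⁺; ∈-upTo⁺)
open import Data.List.Relation.Unary.Unique.Propositional.Properties using (cartesianProduct⁺; upTo⁺; filter⁺)
open import Data.Product using (_,_; proj₁)
import Data.Product as Product
open import Data.Sum using (inj₁; inj₂)
import Data.Sum as Sum
open import Data.Empty using (⊥-elim)
open import Function using (flip; _∘_)
open import Function.Bundles using (mk⇔)
open import Relation.Binary.Definitions using (Transitive)
open import Relation.Binary.PropositionalEquality using (refl; sym; trans; cong; cong₂; subst; module ≡-Reasoning)
open ≡-Reasoning

zeros-++ : ∀ u v → zeros (u ++ v) ≡ zeros u + zeros v
zeros-++ []          v = refl
zeros-++ (false ∷ u) v = cong suc (zeros-++ u v)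
zeros-++ (true ∷ u)  v = zeros-++ u v

ones-++ : ∀ u v → ones (u ++ v) ≡ ones u + ones v
ones-++ []          v = refl
ones-++ (true ∷ u)  v = cong suc (ones-++ u v)
ones-++ (false ∷ u) v = ones-++ u v

ones-reverse : ∀ w → ones (reverse w) ≡ ones w
ones-reverse []      = refl
ones-reverse (b ∷ w) = begin
  ones (reverse (b ∷ w))            ≡⟨ cong ones (unfold-reverse b w) ⟩
  ones (reverse w ++ b ∷ [])        ≡⟨ ones-++ (reverse w) (b ∷ []) ⟩
  ones (reverse w) + ones (b ∷ [])  ≡⟨ cong (_+ ones (b ∷ [])) (ones-reverse w) ⟩
  ones w + ones (b ∷ [])            ≡⟨ +-comm (ones w) _ ⟩
  ones (b ∷ []) + ones w            ≡⟨ ones-++ (b ∷ []) w ⟨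
  ones (b ∷ w)                      ∎

length≡zeros+ones : ∀ w → length w ≡ zeros w + ones w
length≡zeros+ones []          = refl
length≡zeros+ones (false ∷ w) = cong suc (length≡zeros+ones w)
length≡zeros+ones (true ∷ w)  = trans (cong suc (length≡zeros+ones w)) (sym (+-suc (zeros w) (ones w)))

zeros-replicate-false : ∀ k → zeros (replicate k false) ≡ k
zeros-replicate-false zero    = refl
zeros-replicate-false (suc k) = cong suc (zeros-replicate-false k)

zeros-replicate-true : ∀ k → zeros (replicate k true) ≡ 0
zeros-replicate-true zero    = refl
zeros-replicate-true (suc k) = zeros-replicate-true k

ones-replicate-true : ∀ k → ones (replicate k true) ≡ k
ones-replicate-true zero    = refl
ones-replicate-true (suc k) = cong suc (ones-replicate-true k)

ones-replicate-false : ∀ k → ones (replicate k false) ≡ 0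
ones-replicate-false zero    = refl
ones-replicate-false (suc k) = ones-replicate-false k

replicate-++-∷ : ∀ {A : Set} k (x : A) v → replicate k x ++ x ∷ v ≡ x ∷ replicate k x ++ v
replicate-++-∷ zero    x v = refl
replicate-++-∷ (suc k) x v = cong (x ∷_) (replicate-++-∷ k x v)

reverse-replicate : ∀ {A : Set} k (x : A) → reverse (replicate k x) ≡ replicate k x
reverse-replicate zero    x = refl
reverse-replicate (suc k) x = begin
  reverse (x ∷ replicate k x)     ≡⟨ unfold-reverse x (replicate k x) ⟩
  reverse (replicate k x) ++ x ∷ [] ≡⟨ cong (_++ x ∷ []) (reverse-replicate k x) ⟩
  replicate k x ++ x ∷ []         ≡⟨ replicate-++-∷ k x [] ⟩
  x ∷ replicate k x ++ []         ≡⟨ cong (x ∷_) (++-identityʳ (replicate k x)) ⟩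
  x ∷ replicate k x               ∎

sandwich-palindrome : ∀ {A : Set} (u m : List A) → reverse u ≡ u → reverse m ≡ m →
                      u ++ m ++ u ≡ reverse (u ++ m ++ u)
sandwich-palindrome u m rev-u rev-m = begin
  u ++ m ++ u                                 ≡⟨ ++-assoc u m u ⟨
  (u ++ m) ++ u                               ≡⟨ cong₂ (λ a b → (a ++ b) ++ a) (sym rev-u) (sym rev-m) ⟩
  (reverse u ++ reverse m) ++ reverse u       ≡⟨ cong (_++ reverse u) (reverse-++ m u) ⟨
  reverse (m ++ u) ++ reverse u               ≡⟨ reverse-++ u (m ++ u) ⟨
  reverse (u ++ m ++ u)                       ∎

m+m≡m*2 : ∀ m → m + m ≡ m * 2
m+m≡m*2 = solve-∀

-- As (2 + z)(2 + o) is even, z or o is even; that letter is split evenly around a block of the other.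
palindrome-with-counts : ∀ {z o N} → (2 + z) * (2 + o) ≡ 2 * N →
                         ∃[ w ] (w ≡ reverse w × zeros w ≡ z × ones w ≡ o)
palindrome-with-counts {z} {o} {N} eq
  with euclidsLemma (2 + z) (2 + o) prime[2] (divides N (trans eq (*-comm 2 N)))
... | inj₁ 2∣2+z with divides c refl ← ∣m+n∣m⇒∣n 2∣2+z ∣-refl = w , pal , zs , os
  where
  u = replicate c false
  m = replicate o true
  w = u ++ m ++ u
  pal : w ≡ reverse w
  pal = sandwich-palindrome u m (reverse-replicate c false) (reverse-replicate o true)
  zs : zeros w ≡ c * 2
  zs rewrite zeros-++ u (m ++ u) | zeros-++ m u | zeros-replicate-false c | zeros-replicate-true o =
    m+m≡m*2 c
  os : ones w ≡ o
  os rewrite ones-++ u (m ++ u) | ones-++ m u | ones-replicate-false c | ones-replicate-true o =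
    +-identityʳ o
... | inj₂ 2∣2+o with divides c refl ← ∣m+n∣m⇒∣n 2∣2+o ∣-refl = w , pal , zs , os
  where
  u = replicate c true
  m = replicate z false
  w = u ++ m ++ u
  pal : w ≡ reverse w
  pal = sandwich-palindrome u m (reverse-replicate c true) (reverse-replicate z false)
  zs : zeros w ≡ z
  zs rewrite zeros-++ u (m ++ u) | zeros-++ m u | zeros-replicate-true c | zeros-replicate-false z =
    +-identityʳ z
  os : ones w ≡ c * 2
  os rewrite ones-++ u (m ++ u) | ones-++ m u | ones-replicate-true c | ones-replicate-false z =
    m+m≡m*2 c

-- The number of cells left of the lattice path w (true = right, false = up) started in column k.
area : ℕ → List Bool → ℕ
area k []          = 0
area k (true ∷ w)  = area (suc k) w
area k (false ∷ w) = k + area k w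

area-suc : ∀ k w → area (suc k) w ≡ zeros w + area k w
area-suc k []          = refl
area-suc k (true ∷ w)  = area-suc (suc k) w
area-suc k (false ∷ w) = begin
  suc k + area (suc k) w            ≡⟨ cong (suc k +_) (area-suc k w) ⟩
  suc k + (zeros w + area k w)      ≡⟨ cong suc (x∙yz≈y∙xz k (zeros w) (area k w)) ⟩
  suc (zeros w) + (k + area k w)    ∎

area-++ : ∀ k u v → area k (u ++ v) ≡ area k u + area (ones u + k) v
area-++ k []          v = refl
area-++ k (true ∷ u)  v = trans (area-++ (suc k) u v) (cong (λ j → area (suc k) u + area j v) (+-suc (ones u) k))
area-++ k (false ∷ u) v = trans (cong (k +_) (area-++ k u v)) (sym (+-assoc k (area k u) _))

area-replicate-true : ∀ k r w → area k (replicate r true ++ w) ≡ area (r + k) w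
area-replicate-true k zero    w = refl
area-replicate-true k (suc r) w = trans (area-replicate-true (suc k) r w) (cong (λ j → area j w) (+-suc r k))

area-reverse-∷ : ∀ b w → area 0 (reverse (b ∷ w)) ≡ area 0 (reverse w) + area (ones w) (b ∷ [])
area-reverse-∷ b w = begin
  area 0 (reverse (b ∷ w))                                   ≡⟨ cong (area 0) (unfold-reverse b w) ⟩
  area 0 (reverse w ++ b ∷ [])                               ≡⟨ area-++ 0 (reverse w) (b ∷ []) ⟩
  area 0 (reverse w) + area (ones (reverse w) + 0) (b ∷ [])  ≡⟨ cong (λ j → area 0 (reverse w) + area j (b ∷ [])) (trans (+-identityʳ _) (ones-reverse w)) ⟩
  area 0 (reverse w) + area (ones w) (b ∷ [])                ∎

-- The path and its reverse split the zeros × ones rectangle into two complementary regions.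
area+area-reverse : ∀ w → area 0 w + area 0 (reverse w) ≡ zeros w * ones w
area+area-reverse []          = refl
area+area-reverse (true ∷ w)  = begin
  area 1 w + area 0 (reverse (true ∷ w))           ≡⟨ cong₂ _+_ (area-suc 0 w) (trans (area-reverse-∷ true w) (+-identityʳ _)) ⟩
  (zeros w + area 0 w) + area 0 (reverse w)        ≡⟨ +-assoc (zeros w) _ _ ⟩
  zeros w + (area 0 w + area 0 (reverse w))        ≡⟨ cong (zeros w +_) (area+area-reverse w) ⟩
  zeros w + zeros w * ones w                       ≡⟨ *-suc (zeros w) (ones w) ⟨
  zeros w * suc (ones w)                           ∎
area+area-reverse (false ∷ w) = begin
  area 0 w + area 0 (reverse (false ∷ w))          ≡⟨ cong (area 0 w +_) (area-reverse-∷ false w) ⟩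
  area 0 w + (area 0 (reverse w) + (ones w + 0))   ≡⟨ +-assoc (area 0 w) _ _ ⟨
  (area 0 w + area 0 (reverse w)) + (ones w + 0)   ≡⟨ cong₂ _+_ (area+area-reverse w) (+-identityʳ (ones w)) ⟩
  zeros w * ones w + ones w                        ≡⟨ +-comm (zeros w * ones w) (ones w) ⟩
  suc (zeros w) * ones w                           ∎

palindrome-area : ∀ w → w ≡ reverse w → 2 * area 0 w ≡ zeros w * ones w
palindrome-area w pal = begin
  area 0 w + (area 0 w + 0)          ≡⟨ cong (area 0 w +_) (+-identityʳ (area 0 w)) ⟩
  area 0 w + area 0 w                ≡⟨ cong (λ v → area 0 w + area 0 v) pal ⟩
  area 0 w + area 0 (reverse w)      ≡⟨ area+area-reverse w ⟩
  zeros w * ones w                   ∎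

frame-area : ∀ u → area 0 (true ∷ u ++ false ∷ []) ≡ zeros u + area 0 u + suc (ones u)
frame-area u = begin
  area 1 (u ++ false ∷ [])                    ≡⟨ area-++ 1 u (false ∷ []) ⟩
  area 1 u + ((ones u + 1) + 0)               ≡⟨ cong₂ _+_ (area-suc 0 u) (trans (+-identityʳ _) (+-comm (ones u) 1)) ⟩
  zeros u + area 0 u + suc (ones u)           ∎

framed-palindrome-area : ∀ u → u ≡ reverse u →
                         (2 + zeros u) * (2 + ones u) ≡ 2 * (area 0 (true ∷ u ++ false ∷ []) + 1)
framed-palindrome-area u pal = begin
  (2 + z) * (2 + o)              ≡⟨ expand z o ⟩
  z * o + 2 * (z + o + 2)        ≡⟨ cong (_+ 2 * (z + o + 2)) (palindrome-area u pal) ⟨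
  2 * a + 2 * (z + o + 2)        ≡⟨ regroup z a o ⟩
  2 * (z + a + (1 + o) + 1)      ≡⟨ cong (λ t → 2 * (t + 1)) (frame-area u) ⟨
  2 * (area 0 (true ∷ u ++ false ∷ []) + 1) ∎
  where
  z = zeros u
  o = ones u
  a = area 0 u
  expand : ∀ z o → (2 + z) * (2 + o) ≡ z * o + 2 * (z + o + 2)
  expand = solve-∀
  regroup : ∀ z a o → 2 * a + 2 * (z + o + 2) ≡ 2 * (z + a + (1 + o) + 1)
  regroup = solve-∀

Linked-reverseAcc : ∀ {A : Set} {R : A → A → Set} x xs acc →
                    Linked R (x ∷ xs) → Linked (flip R) (x ∷ acc) → Linked (flip R) (reverseAcc (x ∷ acc) xs)
Linked-reverseAcc x []       acc _           r-acc = r-acc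
Linked-reverseAcc x (y ∷ ys) acc (Rxy ∷ r-ys) r-acc = Linked-reverseAcc y ys (x ∷ acc) r-ys (Rxy ∷ r-acc)

Linked-reverse : ∀ {A : Set} {R : A → A → Set} {xs} → Linked R xs → Linked (flip R) (reverse xs)
Linked-reverse {xs = []}     _ = []
Linked-reverse {xs = x ∷ xs} r = Linked-reverseAcc x xs [] r [-]

Linked⇒All-tail : ∀ {A : Set} {R : A → A → Set} → Transitive R → ∀ {x xs} → Linked R (x ∷ xs) → All (R x) xs
Linked⇒All-tail R-trans [-]          = []
Linked⇒All-tail R-trans (Rxy ∷ r-ys) = Linked⇒All R-trans Rxy r-ys

area-boundaryAux : ∀ p xs → Linked _≤_ (p ∷ xs) → area p (boundaryAux p xs) ≡ sum xs
area-boundaryAux p []       _           = refl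
area-boundaryAux p (x ∷ xs) (p≤x ∷ r-xs) = begin
  area p (replicate (x ∸ p) true ++ false ∷ boundaryAux x xs)  ≡⟨ area-replicate-true p (x ∸ p) _ ⟩
  area (x ∸ p + p) (false ∷ boundaryAux x xs)                  ≡⟨ cong (λ k → area k (false ∷ boundaryAux x xs)) (m∸n+n≡m p≤x) ⟩
  x + area x (boundaryAux x xs)                                ≡⟨ cong (x +_) (area-boundaryAux x xs r-xs) ⟩
  x + sum xs                                                   ∎

area-boundary : ∀ {λs} → Linked _≥_ λs → area 0 (boundary λs) ≡ sum λs
area-boundary {λs} r =
  trans (area-boundaryAux 0 (reverse λs) (from-zero (Linked-reverse r))) (sum-↭ (↭-reverse λs))
  where
  from-zero : ∀ {ys} → Linked _≤_ ys → Linked _≤_ (0 ∷ ys)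
  from-zero {[]}    _ = [-]
  from-zero {_ ∷ _} r = z≤n ∷ r

false∷boundaryAux-snoc : ∀ p xs → ∃[ v ] (false ∷ boundaryAux p xs ≡ v ++ false ∷ [])
false∷boundaryAux-snoc p []       = [] , refl
false∷boundaryAux-snoc p (x ∷ xs) with v , eq ← false∷boundaryAux-snoc x xs =
  false ∷ replicate (x ∸ p) true ++ v ,
  cong (false ∷_) (trans (cong (replicate (x ∸ p) true ++_) eq) (sym (++-assoc (replicate (x ∸ p) true) v _)))

boundaryAux-framed : ∀ {ys} → All (0 <_) ys → 0 < sum ys → ∃[ u ] (boundaryAux 0 ys ≡ true ∷ u ++ false ∷ [])
boundaryAux-framed {[]}         _          ()
boundaryAux-framed {zero ∷ _}   (() ∷ _)   _
boundaryAux-framed {suc y ∷ ys} _ _ with v , eq ← false∷boundaryAux-snoc (suc y) ys =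
  replicate y true ++ v ,
  cong (true ∷_) (trans (cong (replicate y true ++_) eq) (sym (++-assoc (replicate y true) v _)))

take-length-++ : ∀ {A : Set} (u v : List A) → take (length u) (u ++ v) ≡ u
take-length-++ []      v = refl
take-length-++ (x ∷ u) v = cong (x ∷_) (take-length-++ u v)

B-framed : ∀ λs u → boundary λs ≡ true ∷ u ++ false ∷ [] → B λs ≡ u
B-framed λs u eq = begin
  B λs                                                 ≡⟨ cong (dropLast ∘ drop 1) eq ⟩
  take (length (u ++ false ∷ []) ∸ 1) (u ++ false ∷ []) ≡⟨ cong (λ k → take (k ∸ 1) (u ++ false ∷ [])) (length-++ u) ⟩
  take (length u + 1 ∸ 1) (u ++ false ∷ [])           ≡⟨ cong (λ k → take k (u ++ false ∷ [])) (m+n∸n≡m (length u) 1) ⟩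
  take (length u) (u ++ false ∷ [])                   ≡⟨ take-length-++ u (false ∷ []) ⟩
  u                                                   ∎

boundary-framed : ∀ {n λs} → IsPartition n λs → n ≥ 1 → boundary λs ≡ true ∷ B λs ++ false ∷ []
boundary-framed {n} {λs} (_ , pos , sum≡n) n≥1
  with u , eq ← boundaryAux-framed (All-resp-↭ (↭-sym (↭-reverse λs)) pos)
                                   (subst (0 <_) (sym (trans (sum-↭ (↭-reverse λs)) sum≡n)) n≥1)
  = trans eq (cong (λ t → true ∷ t ++ false ∷ []) (sym (B-framed λs u eq)))

framed-palindrome-equation : ∀ {λs u} → Linked _≥_ λs → boundary λs ≡ true ∷ u ++ false ∷ [] → u ≡ reverse u →
                             (2 + zeros u) * (2 + ones u) ≡ 2 * (sum λs + 1)
framed-palindrome-equation {λs} {u} r eq pal = begin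
  (2 + zeros u) * (2 + ones u)               ≡⟨ framed-palindrome-area u pal ⟩
  2 * (area 0 (true ∷ u ++ false ∷ []) + 1)  ≡⟨ cong (λ t → 2 * (area 0 t + 1)) eq ⟨
  2 * (area 0 (boundary λs) + 1)             ≡⟨ cong (λ t → 2 * (t + 1)) (area-boundary r) ⟩
  2 * (sum λs + 1)                           ∎

palindromePartition-equation : ∀ {n λs} → n ≥ 1 → IsPalindromePartition n λs →
                               (2 + zeros (B λs)) * (2 + ones (B λs)) ≡ 2 * (n + 1)
palindromePartition-equation n≥1 (part@(r , _ , sum≡n) , pal) =
  trans (framed-palindrome-equation r (boundary-framed part n≥1) pal) (cong (λ t → 2 * (t + 1)) sum≡n)

-- The row lengths, bottom row first, of the diagram whose boundary path from column k is w.
rowLengths : ℕ → List Bool → List ℕ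
rowLengths k []          = []
rowLengths k (true ∷ w)  = rowLengths (suc k) w
rowLengths k (false ∷ w) = k ∷ rowLengths k w

rowLengths-increasing : ∀ k w → Linked _≤_ (k ∷ rowLengths k w)
rowLengths-increasing k []          = [-]
rowLengths-increasing k (true ∷ w)  = lower-head (rowLengths-increasing (suc k) w)
  where
  lower-head : ∀ {xs} → Linked _≤_ (suc k ∷ xs) → Linked _≤_ (k ∷ xs)
  lower-head [-]          = [-]
  lower-head (k<x ∷ r-xs) = <⇒≤ k<x ∷ r-xs
rowLengths-increasing k (false ∷ w) = ≤-refl ∷ rowLengths-increasing k w

boundaryAux-rowLengths : ∀ {p k} w → p ≤ k →
                         boundaryAux p (rowLengths k (w ++ false ∷ [])) ≡ replicate (k ∸ p) true ++ w ++ false ∷ []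
boundaryAux-rowLengths []          p≤k = refl
boundaryAux-rowLengths {p} {k} (false ∷ w) p≤k =
  cong (λ t → replicate (k ∸ p) true ++ false ∷ t)
       (trans (boundaryAux-rowLengths w ≤-refl) (cong (λ j → replicate j true ++ w ++ false ∷ []) (n∸n≡0 k)))
boundaryAux-rowLengths {p} {k} (true ∷ w)  p≤k = begin
  boundaryAux p (rowLengths (suc k) (w ++ false ∷ []))  ≡⟨ boundaryAux-rowLengths w (m≤n⇒m≤1+n p≤k) ⟩
  replicate (suc k ∸ p) true ++ w ++ false ∷ []         ≡⟨ cong (λ j → replicate j true ++ w ++ false ∷ []) (+-∸-assoc 1 p≤k) ⟩
  true ∷ replicate (k ∸ p) true ++ w ++ false ∷ []      ≡⟨ replicate-++-∷ (k ∸ p) true _ ⟨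
  replicate (k ∸ p) true ++ true ∷ w ++ false ∷ []      ∎

framed-word-partition : ∀ u → ∃[ λs ] (Linked _≥_ λs × All (0 <_) λs × boundary λs ≡ true ∷ u ++ false ∷ [])
framed-word-partition u = reverse rows , decreasing , positive , framed
  where
  rows = rowLengths 1 (u ++ false ∷ [])
  decreasing : Linked _≥_ (reverse rows)
  decreasing = Linked-reverse (tail (rowLengths-increasing 1 (u ++ false ∷ [])))
  positive : All (0 <_) (reverse rows)
  positive = All-resp-↭ (↭-sym (↭-reverse rows)) (Linked⇒All-tail ≤-trans (rowLengths-increasing 1 (u ++ false ∷ [])))
  framed : boundary (reverse rows) ≡ true ∷ u ++ false ∷ []
  framed = trans (cong (boundaryAux 0) (reverse-involutive rows)) (boundaryAux-rowLengths u z≤n)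

palindromePartition-exists : ∀ {n z o} → (2 + z) * (2 + o) ≡ 2 * (n + 1) →
                             ∃[ λs ] (IsPalindromePartition n λs × zeros (B λs) ≡ z × ones (B λs) ≡ o)
palindromePartition-exists {n} {z} {o} eq
  with w , pal , zeros≡z , ones≡o ← palindrome-with-counts {N = n + 1} eq
  with λs , r , pos , framed ← framed-word-partition w
  = λs , ((r , pos , sum≡n) , palindromic) , trans (cong zeros B≡w) zeros≡z , trans (cong ones B≡w) ones≡o
  where
  B≡w : B λs ≡ w
  B≡w = B-framed λs w framed
  palindromic : B λs ≡ reverse (B λs)
  palindromic = subst (λ t → t ≡ reverse t) (sym B≡w) pal
  double : 2 * (sum λs + 1) ≡ 2 * (n + 1)
  double = begin
    2 * (sum λs + 1)              ≡⟨ framed-palindrome-equation r framed pal ⟨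
    (2 + zeros w) * (2 + ones w)  ≡⟨ cong₂ (λ a b → (2 + a) * (2 + b)) zeros≡z ones≡o ⟩
    (2 + z) * (2 + o)             ≡⟨ eq ⟩
    2 * (n + 1)                   ∎
  sum≡n : sum λs ≡ n
  sum≡n = +-cancelʳ-≡ 1 (sum λs) n (*-cancelˡ-≡ (sum λs + 1) (n + 1) 2 double)

-- p is a root of t² − (r + s) t + r s = (t − r)(t − s).
sum-product-determine : ∀ {p q r s} → p + q ≡ r + s → p * q ≡ r * s → (p ≡ r × q ≡ s) ⊎ (p ≡ s × q ≡ r)
sum-product-determine {p} {q} {r} {s} sum≡ product≡
  with ℤ.i*j≡0⇒i≡0∨j≡0 (P ℤ.- R) roots
  where
  P = ℤ.+ p
  Q = ℤ.+ q
  R = ℤ.+ r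
  S = ℤ.+ s
  sumℤ : R ℤ.+ S ≡ P ℤ.+ Q
  sumℤ = trans (sym (ℤ.pos-+ r s)) (trans (cong ℤ.+_ (sym sum≡)) (ℤ.pos-+ p q))
  productℤ : R ℤ.* S ≡ P ℤ.* Q
  productℤ = trans (sym (ℤ.pos-* r s)) (trans (cong ℤ.+_ (sym product≡)) (ℤ.pos-* p q))
  expand : ∀ P R S → (P ℤ.- R) ℤ.* (P ℤ.- S) ≡ P ℤ.* P ℤ.- P ℤ.* (R ℤ.+ S) ℤ.+ R ℤ.* S
  expand = ℤ-Solver.solve-∀
  vanish : ∀ P Q → P ℤ.* P ℤ.- P ℤ.* (P ℤ.+ Q) ℤ.+ P ℤ.* Q ≡ ℤ.0ℤ
  vanish = ℤ-Solver.solve-∀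
  roots : (P ℤ.- R) ℤ.* (P ℤ.- S) ≡ ℤ.0ℤ
  roots = trans (expand P R S)
                (trans (cong₂ (λ a b → P ℤ.* P ℤ.- P ℤ.* a ℤ.+ b) sumℤ productℤ) (vanish P Q))
... | inj₁ P-R≡0 = inj₁ (p≡r , +-cancelˡ-≡ p q s (trans sum≡ (cong (_+ s) (sym p≡r))))
  where
  p≡r : p ≡ r
  p≡r = ℤ.+-injective (ℤ.i-j≡0⇒i≡j _ _ P-R≡0)
... | inj₂ P-S≡0 = inj₂ (p≡s , +-cancelˡ-≡ p q r (trans sum≡ (trans (cong (r +_) (sym p≡s)) (+-comm r p))))
  where
  p≡s : p ≡ s
  p≡s = ℤ.+-injective (ℤ.i-j≡0⇒i≡j _ _ P-S≡0)

shifted-pair-determined : ∀ {z₁ o₁ z₂ o₂} → z₁ + o₁ ≡ z₂ + o₂ → (2 + z₁) * (2 + o₁) ≡ (2 + z₂) * (2 + o₂) →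
                          (z₁ ≡ z₂ × o₁ ≡ o₂) ⊎ (z₁ ≡ o₂ × o₁ ≡ z₂)
shifted-pair-determined {z₁} {o₁} {z₂} {o₂} sum≡ product≡ =
  Sum.map (Product.map unshift unshift) (Product.map unshift unshift)
          (sum-product-determine (trans (shift z₁ o₁) (trans (cong (4 +_) sum≡) (sym (shift z₂ o₂)))) product≡)
  where
  shift : ∀ z o → (2 + z) + (2 + o) ≡ 4 + (z + o)
  shift = solve-∀
  unshift : ∀ {a b} → 2 + a ≡ 2 + b → a ≡ b
  unshift = +-cancelˡ-≡ 2 _ _

goodPair-shifted : ∀ {n x y} → GoodPair n (x , y) → ∃[ z ] ∃[ o ] ((x , y) ≡ (2 + z , 2 + o))
goodPair-shifted {x = zero}          (_ , () , _)
goodPair-shifted {n} {x = 1} {y}     (1*y≡ , _ , _ , y≤n+1) = ⊥-elim (m+1+n≰m n (s≤s⁻¹ 2[1+n]≤1+n))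
  where
  2[1+n]≤1+n : 2 * suc n ≤ suc n
  2[1+n]≤1+n = subst (λ m → 2 * m ≤ m) (+-comm n 1) (subst (_≤ n + 1) (trans (sym (*-identityˡ y)) 1*y≡) y≤n+1)
goodPair-shifted {x = suc (suc z)} {zero}        (_ , _ , () , _)
goodPair-shifted {x = suc (suc z)} {1}           (_ , _ , s≤s () , _)
goodPair-shifted {x = suc (suc z)} {suc (suc o)} _ = z , o , refl

goodPair-intro : ∀ {n z o} → (2 + z) * (2 + o) ≡ 2 * (n + 1) → z ≤ o → GoodPair n (2 + z , 2 + o)
goodPair-intro {n} {z} {o} eq z≤o = eq , s≤s z≤n , s≤s (s≤s z≤o) , *-cancelˡ-≤ 2 2[2+o]≤2[n+1]
  where
  2[2+o]≤2[n+1] : 2 * (2 + o) ≤ 2 * (n + 1)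
  2[2+o]≤2[n+1] = subst (2 * (2 + o) ≤_) eq (*-monoˡ-≤ (2 + o) {2} {2 + z} (s≤s (s≤s z≤n)))

concatMap-pairs : ∀ {A B : Set} (xs : List A) (ys : List B) →
                  concatMap (λ x → map (λ y → (x , y)) ys) xs ≡ cartesianProduct xs ys
concatMap-pairs []       ys = refl
concatMap-pairs (x ∷ xs) ys = cong (map (x ,_) ys ++_) (concatMap-pairs xs ys)

Unique-pairsUpTo : ∀ n → Unique (pairsUpTo n)
Unique-pairsUpTo n = subst Unique (sym (concatMap-pairs (upTo (2 + n)) (upTo (2 + n))))
                           (cartesianProduct⁺ (upTo⁺ (2 + n)) (upTo⁺ (2 + n)))

goodPair⇒∈pairsUpTo : ∀ {n x y} → GoodPair n (x , y) → (x , y) ∈ pairsUpTo n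
goodPair⇒∈pairsUpTo {n} {x} {y} (_ , _ , x≤y , y≤n+1) =
  subst ((x , y) ∈_) (sym (concatMap-pairs (upTo (2 + n)) (upTo (2 + n))))
        (∈-cartesianProduct⁺ (∈-upTo⁺ (<-≤-trans (s≤s x≤y) y<2+n)) (∈-upTo⁺ y<2+n))
  where
  y<2+n : y < 2 + n
  y<2+n = s≤s (subst (y ≤_) (+-comm n 1) y≤n+1)

Unique-map-injectiveOn : ∀ {A B : Set} {P : A → Set} {f : A → B} {xs} →
                         (∀ {x y} → P x → P y → f x ≡ f y → x ≡ y) → All P xs → Unique xs → Unique (map f xs)
Unique-map-injectiveOn {P = P} injective all-P unique =
  AllPairsₚ.map⁺ (AllPairs.zipWith (λ { (x≢y , Px , Py) fx≡fy → x≢y (injective Px Py fx≡fy) }) (unique , both all-P))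
  where
  both : ∀ {xs} → All P xs → AllPairs (λ x y → P x × P y) xs
  both []           = []
  both (Px ∷ all-P) = All.map (Px ,_) all-P ∷ both all-P

-- A good pair (x , y) is (2 + zeros , 2 + ones) of some B(λ).
pairLength : ℕ × ℕ → ℕ
pairLength (x , y) = (x ∸ 2) + (y ∸ 2)

goodPairs : ℕ → List (ℕ × ℕ)
goodPairs n = filter (goodPair? n) (pairsUpTo n)

palindromeLengths : ℕ → List ℕ
palindromeLengths n = map pairLength (goodPairs n)

shifted-goodPair-injective : ∀ {n z₁ o₁ z₂ o₂} → GoodPair n (2 + z₁ , 2 + o₁) → GoodPair n (2 + z₂ , 2 + o₂) →
                             z₁ + o₁ ≡ z₂ + o₂ → (z₁ , o₁) ≡ (z₂ , o₂)
shifted-goodPair-injective {z₁ = z₁} {o₁} {z₂} {o₂} (eq₁ , _ , s≤s (s≤s z₁≤o₁) , _) (eq₂ , _ , s≤s (s≤s z₂≤o₂) , _) sum≡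
  with shifted-pair-determined {z₁} {o₁} {z₂} {o₂} sum≡ (trans eq₁ (sym eq₂))
... | inj₁ (refl , refl)   = refl
... | inj₂ (z₁≡o₂ , o₁≡z₂) = cong₂ _,_ z₁≡z₂ (trans o₁≡z₂ (trans (sym z₁≡z₂) z₁≡o₂))
  where
  z₁≡z₂ : z₁ ≡ z₂
  z₁≡z₂ = ≤-antisym (subst (_ ≤_) o₁≡z₂ z₁≤o₁) (subst (_ ≤_) (sym z₁≡o₂) z₂≤o₂)

pairLength-injectiveOn-goodPairs : ∀ {n p q} → GoodPair n p → GoodPair n q → pairLength p ≡ pairLength q → p ≡ q
pairLength-injectiveOn-goodPairs gp gq length≡ with goodPair-shifted gp | goodPair-shifted gq
... | _ , _ , refl | _ , _ , refl =
  cong (λ { (z , o) → (2 + z , 2 + o) }) (shifted-goodPair-injective gp gq length≡)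

goodPair⇒∈palindromeLengths : ∀ {n z o} → GoodPair n (2 + z , 2 + o) → z + o ∈ palindromeLengths n
goodPair⇒∈palindromeLengths {n} good = ∈-map⁺ pairLength (∈-filter⁺ (goodPair? n) (goodPair⇒∈pairsUpTo good) good)

∈-palindromeLengths : ∀ {n z o} → (2 + z) * (2 + o) ≡ 2 * (n + 1) → z + o ∈ palindromeLengths n
∈-palindromeLengths {n} {z} {o} eq with ≤-total z o
... | inj₁ z≤o = goodPair⇒∈palindromeLengths (goodPair-intro {n} eq z≤o)
... | inj₂ o≤z = subst (_∈ palindromeLengths n) (+-comm o z)
                       (goodPair⇒∈palindromeLengths (goodPair-intro {n} (trans (*-comm (2 + o) (2 + z)) eq) o≤z))

Unique-palindromeLengths : ∀ n → Unique (palindromeLengths n)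
Unique-palindromeLengths n =
  Unique-map-injectiveOn pairLength-injectiveOn-goodPairs (all-filter (goodPair? n) (pairsUpTo n))
                         (filter⁺ (goodPair? n) (Unique-pairsUpTo n))

palindromePartition-with-length : ∀ {n z o} → (2 + z) * (2 + o) ≡ 2 * (n + 1) →
                                  ∃[ λs ] (IsPalindromePartition n λs × length (B λs) ≡ z + o)
palindromePartition-with-length {n} {z} {o} eq = counts⇒length (palindromePartition-exists {n} {z} {o} eq)
  where
  counts⇒length : ∃[ λs ] (IsPalindromePartition n λs × zeros (B λs) ≡ z × ones (B λs) ≡ o) →
                  ∃[ λs ] (IsPalindromePartition n λs × length (B λs) ≡ z + o)
  counts⇒length (λs , palindrome , zeros≡z , ones≡o) =
    λs , palindrome , trans (length≡zeros+ones (B λs)) (cong₂ _+_ zeros≡z ones≡o)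

palindromeLengths-spec : ∀ {n} → n ≥ 1 → ∀ m →
                         (m ∈ palindromeLengths n) ⇔ (∃[ λs ] (IsPalindromePartition n λs × length (B λs) ≡ m))
palindromeLengths-spec {n} n≥1 m = mk⇔ realised listed
  where
  realised : m ∈ palindromeLengths n → ∃[ λs ] (IsPalindromePartition n λs × length (B λs) ≡ m)
  realised m∈ with p , p∈ , refl ← ∈-map⁻ pairLength m∈
              with _ , good ← ∈-filter⁻ (goodPair? n) {xs = pairsUpTo n} p∈
              with z , o , refl ← goodPair-shifted good
    = palindromePartition-with-length {n} {z} {o} (proj₁ good)
  listed : ∃[ λs ] (IsPalindromePartition n λs × length (B λs) ≡ m) → m ∈ palindromeLengths n
  listed (λs , palindrome , length≡m) =
    subst (_∈ palindromeLengths n) (trans (sym (length≡zeros+ones (B λs))) length≡m)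
          (∈-palindromeLengths {n} (palindromePartition-equation n≥1 palindrome))

palindromePartition-counts : ∀ {n} → n ≥ 1 → ∀ λs μs → IsPalindromePartition n λs → IsPalindromePartition n μs →
                             length (B λs) ≡ length (B μs) →
                             ((zeros (B μs) ≡ zeros (B λs)) × (ones (B μs) ≡ ones (B λs)))
                             ⊎ ((zeros (B μs) ≡ ones (B λs)) × (ones (B μs) ≡ zeros (B λs)))
palindromePartition-counts n≥1 λs μs palindromeλ palindromeμ length≡ =
  shifted-pair-determined (trans (sym (length≡zeros+ones (B μs))) (trans (sym length≡) (length≡zeros+ones (B λs))))
                          (trans (palindromePartition-equation n≥1 palindromeμ) (sym (palindromePartition-equation n≥1 palindromeλ)))

theorem4p2 : (n : ℕ) → n ≥ 1 →
    -- PL(n) = numPairs n : the set of lengths of B(λ), λ a palindrome partition of n,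
    -- is listed without repetition by a list of length numPairs n
    (Σ (List ℕ) (λ ls → Unique ls
        × (∀ m → (m ∈ ls) ⇔ (∃[ λs ] (IsPalindromePartition n λs × length (B λs) ≡ m)))
        × length ls ≡ numPairs n))
    × (∀ λs μs → IsPalindromePartition n λs → IsPalindromePartition n μs →
         length (B λs) ≡ length (B μs) →
         ((zeros (B μs) ≡ zeros (B λs)) × (ones (B μs) ≡ ones (B λs)))
         ⊎ ((zeros (B μs) ≡ ones (B λs)) × (ones (B μs) ≡ zeros (B λs))))
theorem4p2 n n≥1 =
  ( palindromeLengths n
  , Unique-palindromeLengths n
  , palindromeLengths-spec n≥1
  , length-map pairLength (goodPairs n) )
  , palindromePartition-counts n≥1
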